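{- For any $n\ge1$, the number of tetrahedron circuits in $\mathcal{A}_n$ is $S(n+1,4)$.
   Context: $\mathcal{A}_n$ is the resonance arrangement in $\mathbb{R}^n$ consisting of the hyperplanes $H_I=\{x:\sum_{i\in I}x_i=0\}$, $\emptyset\ne I\subseteq[n]$, with normal vectors $\chi_I$ (characteristic vectors). A tetrahedron circuit of $\mathcal{A}_n$ is a set of four hyperplanes of the form $\{H_{A_1},H_{A_3},H_{A_1\triangle A_3},H_{A_1\cup A_3}\}$ with $A_1,A_3\subseteq[n]$, $A_1\cap A_3\ne\emptyset$, $A_1\setminus A_3\neq\emptyset$, $A_3\setminus A_1\ne\emptyset$; equivalently, four distinct nonempty subsets $A_1,A_2,A_3,A_4$ with $A_1,A_2,A_3$ pairwise intersecting and $\chi_{A_1}+\chi_{A_2}+\chi_{A_3}=2\chi_{A_4}$. Circuits are counted as sets of hyperplanes. $S(n,k)$ is the Stirling number of the second kind. -}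

module Defs where

open import Data.Nat using (ℕ; zero; suc; _+_; _*_)
open import Data.Bool using (Bool; true; false)
import Data.Bool as Bool
open import Data.List using (List; []; _∷_; _++_; map; filter; length)
open import Data.List.Relation.Unary.All using (All; all?)
open import Data.Product using (∃; ∃-syntax; _×_; _,_)
open import Data.Product.Properties using (≡-dec)
open import Relation.Nullary using (Dec; yes; no)
open import Relation.Nullary.Decidable using (_×-dec_)
open import Relation.Binary.PropositionalEquality using (_≡_)
open import Data.Fin.Subset using (Subset; inside; outside; Nonempty; _∩_; _∪_; _─_)
open import Data.Fin.Subset.Properties using (nonempty?; anySubset?)
import Data.Vec.Properties as VecP
open import Data.Vec using ([]; _∷_)
import Data.List.Membership.DecPropositional

S : ℕ → ℕ → ℕ
S zero    zero    = 1
S zero    (suc k) = 0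
S (suc n) zero    = 0
S (suc n) (suc k) = suc k * S n (suc k) + S n k

_≟ˢ_ : ∀ {n} (A B : Subset n) → Dec (A ≡ B)
_≟ˢ_ = VecP.≡-dec Bool._≟_

module Mem (n : ℕ) = Data.List.Membership.DecPropositional (_≟ˢ_ {n})

_∈_ : ∀ {n} → Subset n → List (Subset n) → Set
_∈_ {n} = Mem._∈_ n

_∈?_ : ∀ {n} (x : Subset n) (xs : List (Subset n)) → Dec (x ∈ xs)
_∈?_ {n} = Mem._∈?_ n

allSubsets : ∀ n → List (Subset n)
allSubsets zero    = [] ∷ []
allSubsets (suc n) = map (inside ∷_) (allSubsets n) ++ map (outside ∷_) (allSubsets n)

-- the nonempty subsets I ⊆ [n]; these index the hyperplanes H_I of 𝒜_n
-- (distinct nonempty I give distinct hyperplanes, since distinct 0/1 vectors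
--  are never proportional)
nonemptySubsets : ∀ n → List (Subset n)
nonemptySubsets n = filter nonempty? (allSubsets n)

-- all k-element sublists (order-preserving) of a list: for a duplicate-free
-- list these are exactly the k-element subsets, each listed once
choose : ∀ {a} {A : Set a} → ℕ → List A → List (List A)
choose zero    xs       = [] ∷ []
choose (suc k) []       = []
choose (suc k) (x ∷ xs) = map (x ∷_) (choose k xs) ++ choose (suc k) xs

_△_ : ∀ {n} → Subset n → Subset n → Subset n
A △ B = (A ─ B) ∪ (B ─ A)

tetra : ∀ {n} → Subset n → Subset n → List (Subset n)
tetra A B = A ∷ B ∷ (A △ B) ∷ (A ∪ B) ∷ []

IsTetrahedron : ∀ {n} → List (Subset n) → Set
IsTetrahedron {n} L =
  ∃[ A₁ ] ∃[ A₃ ]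
    ( Nonempty (A₁ ∩ A₃) × Nonempty (A₁ ─ A₃) × Nonempty (A₃ ─ A₁)
    × All (_∈ tetra A₁ A₃) L × All (_∈ L) (tetra A₁ A₃) )

isTetrahedron? : ∀ {n} (L : List (Subset n)) → Dec (IsTetrahedron L)
isTetrahedron? L =
  anySubset? λ A₁ → anySubset? λ A₃ →
    nonempty? (A₁ ∩ A₃) ×-dec nonempty? (A₁ ─ A₃) ×-dec nonempty? (A₃ ─ A₁)
    ×-dec all? (_∈? tetra A₁ A₃) L ×-dec all? (_∈? L) (tetra A₁ A₃)

tetrahedronCircuits : ∀ n → List (List (Subset n))
tetrahedronCircuits n = filter isTetrahedron? (choose 4 (nonemptySubsets n))

numTetrahedronCircuits : ℕ → ℕ
numTetrahedronCircuits n = length (tetrahedronCircuits n)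

-- A circuit {A₁, A₃, A₁ △ A₃, A₁ ∪ A₃} only depends on the blocks
-- X = A₁ ∩ A₃, Y = A₁ ∖ A₃, Z = A₃ ∖ A₁ (all nonempty) and W = [n] ∖ (A₁ ∪ A₃):
-- its members are the three sides X∪Y, X∪Z, Y∪Z and the top X∪Y∪Z, and
-- any two sides span the third (`triangle`).  We record the blocks as a
-- word over {W, X, Y, Z} and normalise the labelling of X, Y, Z by asking
-- the list U, XY, XZ, YZ of its sets to be lexicographically sorted, the
-- form in which `choose` lists circuits.  Sortedness holds exactly when X,
-- Y, Z occur and first occur in this order, which a five-state automaton
-- checks letter by letter.  So circuits correspond bijectively to the
-- accepted words, i.e. to the partitions of [n+1] into four blocks, and a
-- generic enumeration of automaton languages, grouped by the last letter,
-- counts them by the Stirling recurrence.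
module Submission where

open import Defs hiding (_∈_)
open import Data.Nat using (ℕ; zero; suc; _≥_; _+_; _*_)
open import Data.Nat.Properties using (+-comm)
open import Data.Bool using (Bool; true; false)
open import Data.Vec using (Vec; []; _∷_; _∷ʳ_; here; there; initLast; zipWith; head) renaming (map to mapV)
import Data.Vec.Properties as Vecₚ
import Data.List.Properties as Listₚ
open import Data.List using (List; []; _∷_; _++_; map; filter; length; concatMap; cartesianProduct; allFin)
open import Data.List.Relation.Unary.All using (All; []; _∷_)
import Data.List.Relation.Unary.All as All
import Data.List.Relation.Unary.All.Properties as Allₚ
open import Data.List.Relation.Unary.Any using (here; there)
open import Data.List.Relation.Unary.AllPairs using (AllPairs; []; _∷_)
import Data.List.Relation.Unary.AllPairs as AllPairs
import Data.List.Relation.Unary.AllPairs.Properties as AllPairsₚ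
open import Data.List.Relation.Unary.Unique.Propositional using (Unique)
import Data.List.Relation.Unary.Unique.Propositional.Properties as Uniqueₚ
open import Data.List.Membership.Propositional using (_∈_; find; lose)
open import Data.List.Membership.Propositional.Properties
  using (∈-map⁺; ∈-map⁻; ∈-++⁺ˡ; ∈-++⁺ʳ; ∈-++⁻; ∈-filter⁺; ∈-filter⁻; ∈-concatMap⁺; ∈-concatMap⁻;
         ∈-cartesianProduct⁺; ∈-allFin)
open import Data.Nat.ListAction using (sum)
open import Data.Product using (∃-syntax; _×_; _,_; proj₁; proj₂)
open import Data.Sum using (inj₁; inj₂)
open import Data.Empty using (⊥; ⊥-elim)
open import Data.Fin using (Fin; zero; suc)
open import Data.Fin.Properties using () renaming (_≟_ to _≟ᶠ_)
open import Data.Fin.Subset using (Subset; inside; outside; Nonempty; _⊆_; _∪_; _∩_; _─_)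
open import Data.Fin.Subset.Properties
  using (nonempty?; drop-∷-⊆; ⊆-refl; p⊆p∪q; q⊆p∪q; x∈p∪q⁺; x∈p∩q⁻)
open import Data.List.Membership.Propositional.Properties.WithK using (unique∧set⇒bag)
open import Data.List.Relation.Binary.BagAndSetEquality using (∼bag⇒↭)
open import Data.List.Relation.Binary.Permutation.Propositional using (_↭_)
open import Data.List.Relation.Binary.Permutation.Propositional.Properties using (↭-length)
open import Function.Bundles using (mk⇔)
open import Relation.Nullary using (¬_; yes; no)
open import Relation.Binary.Definitions using (DecidableEquality)
open import Relation.Binary.PropositionalEquality
  using (_≡_; _≢_; refl; sym; trans; cong; cong₂; subst; module ≡-Reasoning)

pattern 1st = here refl
pattern 2nd = there (here refl)
pattern 3rd = there (there (here refl))
pattern 4th = there (there (there (here refl)))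

-- Lexicographic order on subsets of [n], read as words with inside
-- before outside.  `allSubsets` lists the subsets in increasing order,
-- so every list produced by `choose` from it is sorted.
data _≺_ : ∀ {n} → Subset n → Subset n → Set where
  ≺-here  : ∀ {n} {p q : Subset n} → (inside ∷ p) ≺ (outside ∷ q)
  ≺-there : ∀ {n} {x} {p q : Subset n} → p ≺ q → (x ∷ p) ≺ (x ∷ q)

≺-irrefl : ∀ {n} {p : Subset n} → ¬ (p ≺ p)
≺-irrefl (≺-there p≺p) = ≺-irrefl p≺p

≺-trans : ∀ {n} {p q r : Subset n} → p ≺ q → q ≺ r → p ≺ r
≺-trans ≺-here        (≺-there _)   = ≺-here
≺-trans (≺-there _)   ≺-here        = ≺-here
≺-trans (≺-there p≺q) (≺-there q≺r) = ≺-there (≺-trans p≺q q≺r)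

≺-asym : ∀ {n} {p q : Subset n} → p ≺ q → ¬ (q ≺ p)
≺-asym p≺q q≺p = ≺-irrefl (≺-trans p≺q q≺p)

≺⇒≢ : ∀ {n} {p q : Subset n} → p ≺ q → p ≢ q
≺⇒≢ p≺q refl = ≺-irrefl p≺q

-- The first position where p ≺ q differ lies in p but not in q.
≺⇒Nonempty─ : ∀ {n} {p q : Subset n} → p ≺ q → Nonempty (p ─ q)
≺⇒Nonempty─ ≺-here = zero , here
≺⇒Nonempty─ (≺-there p≺q) with ≺⇒Nonempty─ p≺q
... | i , i∈p─q = suc i , there i∈p─q

⊆⇒⊀ : ∀ {n} {p q : Subset n} → p ⊆ q → ¬ (p ≺ q)
⊆⇒⊀ p⊆q ≺-here with p⊆q here
... | ()
⊆⇒⊀ p⊆q (≺-there p≺q) = ⊆⇒⊀ (drop-∷-⊆ p⊆q) p≺q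

module _ {a} {A : Set a} where

  choose-⊆ : ∀ k (ys : List A) {xs} → xs ∈ choose k ys → All (_∈ ys) xs
  choose-⊆ zero    ys       (here refl) = []
  choose-⊆ (suc k) (y ∷ ys) xs∈ with ∈-++⁻ (map (y ∷_) (choose k ys)) xs∈
  ... | inj₂ xs∈′ = All.map there (choose-⊆ (suc k) ys xs∈′)
  ... | inj₁ xs∈′ with ∈-map⁻ (y ∷_) xs∈′
  ...   | zs , zs∈ , refl = here refl ∷ All.map there (choose-⊆ k ys zs∈)

  choose-length : ∀ k (ys : List A) {xs} → xs ∈ choose k ys → length xs ≡ k
  choose-length zero    ys       (here refl) = refl
  choose-length (suc k) (y ∷ ys) xs∈ with ∈-++⁻ (map (y ∷_) (choose k ys)) xs∈
  ... | inj₂ xs∈′ = choose-length (suc k) ys xs∈′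
  ... | inj₁ xs∈′ with ∈-map⁻ (y ∷_) xs∈′
  ...   | zs , zs∈ , refl = cong suc (choose-length k ys zs∈)

  choose-unique : ∀ k {ys : List A} → Unique ys → Unique (choose k ys)
  choose-unique zero    _          = [] ∷ []
  choose-unique (suc k) {[]}     _ = []
  choose-unique (suc k) {y ∷ ys} (y∉ys ∷ ys!) =
    Uniqueₚ.++⁺ (Uniqueₚ.map⁺ Listₚ.∷-injectiveʳ (choose-unique k ys!)) (choose-unique (suc k) ys!) disjoint
    where
    disjoint : ∀ {xs} → ¬ (xs ∈ map (y ∷_) (choose k ys) × xs ∈ choose (suc k) ys)
    disjoint (xs∈ , xs∈′) with ∈-map⁻ (y ∷_) xs∈
    ... | _ , _ , refl with choose-⊆ (suc k) ys xs∈′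
    ...   | y∈ys ∷ _ = All.lookup y∉ys y∈ys refl

module SortedSublists {a ℓ} {A : Set a} (_<_ : A → A → Set ℓ)
  (<-irrefl : ∀ {x} → ¬ (x < x)) (<-asym : ∀ {x y} → x < y → ¬ (y < x))
  (_≟_ : DecidableEquality A) where

  Sorted : List A → Set _
  Sorted = AllPairs _<_

  choose-sorted : ∀ k {ys xs} → Sorted ys → xs ∈ choose k ys → Sorted xs
  choose-sorted zero    {ys}     _ (here refl) = []
  choose-sorted (suc k) {y ∷ ys} (y< ∷ ys↑) xs∈ with ∈-++⁻ (map (y ∷_) (choose k ys)) xs∈
  ... | inj₂ xs∈′ = choose-sorted (suc k) ys↑ xs∈′
  ... | inj₁ xs∈′ with ∈-map⁻ (y ∷_) xs∈′
  ...   | zs , zs∈ , refl = All.map (All.lookup y<) (choose-⊆ k ys zs∈) ∷ choose-sorted k ys↑ zs∈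

  private
    strip : ∀ {y : A} {ys zs : List A} → All (_∈ y ∷ ys) zs → All (_≢ y) zs → All (_∈ ys) zs
    strip []                 []            = []
    strip (here z≡y ∷ zs∈)   (z≢y ∷ _)     = ⊥-elim (z≢y z≡y)
    strip (there z∈ys ∷ zs∈) (_   ∷ zs≢y) = z∈ys ∷ strip zs∈ zs≢y

  choose-complete : ∀ {ys xs} → Sorted ys → Sorted xs → All (_∈ ys) xs →
                    xs ∈ choose (length xs) ys
  choose-complete {ys}     {[]}     _          _          _ = here refl
  choose-complete {[]}     {x ∷ xs} _          _          (() ∷ _)
  choose-complete {y ∷ ys} {x ∷ xs} (y< ∷ ys↑) (x< ∷ xs↑) (x∈ ∷ xs∈) with x ≟ y
  ... | yes refl = ∈-++⁺ˡ (∈-map⁺ (x ∷_) (choose-complete ys↑ xs↑ (strip xs∈ xs≢x)))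
    where
    xs≢x : All (_≢ x) xs
    xs≢x = All.map (λ {z} x<z (z≡x : z ≡ x) → <-irrefl (subst (x <_) z≡x x<z)) x<
  ... | no x≢y = ∈-++⁺ʳ _ (choose-complete ys↑ (x< ∷ xs↑) (strip (x∈ ∷ xs∈) (x≢y ∷ xs≢y)))
    where
    y<x : y < x
    y<x = All.lookup y< (All.head (strip (x∈ ∷ []) (x≢y ∷ [])))
    xs≢y : All (_≢ y) xs
    xs≢y = All.map (λ {z} x<z (z≡y : z ≡ y) → <-asym (subst (x <_) z≡y x<z) y<x) x<

open module SortedSubsets {n} = SortedSublists (_≺_ {n}) ≺-irrefl ≺-asym (_≟ˢ_ {n})

allSubsets-sorted : ∀ n → Sorted (allSubsets n)
allSubsets-sorted zero    = [] ∷ []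
allSubsets-sorted (suc n) =
  AllPairsₚ.++⁺ (insert inside) (insert outside)
    (Allₚ.map⁺ (All.tabulate λ _ → Allₚ.map⁺ (All.tabulate λ _ → ≺-here)))
  where
  insert : ∀ x → Sorted (map (x ∷_) (allSubsets n))
  insert x = AllPairsₚ.map⁺ (AllPairs.map ≺-there (allSubsets-sorted n))

∈-allSubsets : ∀ n (p : Subset n) → p ∈ allSubsets n
∈-allSubsets zero    []            = here refl
∈-allSubsets (suc n) (inside ∷ p)  = ∈-++⁺ˡ (∈-map⁺ (inside ∷_) (∈-allSubsets n p))
∈-allSubsets (suc n) (outside ∷ p) = ∈-++⁺ʳ _ (∈-map⁺ (outside ∷_) (∈-allSubsets n p))

nonemptySubsets-sorted : ∀ n → Sorted (nonemptySubsets n)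
nonemptySubsets-sorted n = AllPairsₚ.filter⁺ nonempty? (allSubsets-sorted n)

nonemptySubsets-unique : ∀ n → Unique (nonemptySubsets n)
nonemptySubsets-unique n = AllPairs.map ≺⇒≢ (nonemptySubsets-sorted n)

∈-nonemptySubsets : ∀ n {p : Subset n} → Nonempty p → p ∈ nonemptySubsets n
∈-nonemptySubsets n {p} = ∈-filter⁺ nonempty? (∈-allSubsets n p)

length-concatMap : ∀ {a b} {A : Set a} {B : Set b} (f : A → List B) xs →
                   length (concatMap f xs) ≡ sum (map (λ x → length (f x)) xs)
length-concatMap f []       = refl
length-concatMap f (x ∷ xs) = trans (Listₚ.length-++ (f x)) (cong (length (f x) +_) (length-concatMap f xs))

module Automaton {r k : ℕ} (δ : Fin r → Fin k → Fin r) (q₀ : Fin r) where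

  run : ∀ {m} → Fin r → Vec (Fin k) m → Fin r
  run q []      = q
  run q (a ∷ w) = run (δ q a) w

  run-∷ʳ : ∀ {m} q (u : Vec (Fin k) m) a → run q (u ∷ʳ a) ≡ δ (run q u) a
  run-∷ʳ q []      a = refl
  run-∷ʳ q (b ∷ u) a = run-∷ʳ (δ q b) u a

  into : Fin r → List (Fin r × Fin k)
  into t = filter (λ p → δ (proj₁ p) (proj₂ p) ≟ᶠ t) (cartesianProduct (allFin r) (allFin k))

  into-sound : ∀ {t q a} → (q , a) ∈ into t → δ q a ≡ t
  into-sound {t} qa∈ =
    proj₂ (∈-filter⁻ (λ p → δ (proj₁ p) (proj₂ p) ≟ᶠ t)
                     {xs = cartesianProduct (allFin r) (allFin k)} qa∈)

  into-complete : ∀ q a → (q , a) ∈ into (δ q a)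
  into-complete q a = ∈-filter⁺ _ (∈-cartesianProduct⁺ (∈-allFin q) (∈-allFin a)) refl

  into-unique : ∀ t → Unique (into t)
  into-unique t = Uniqueₚ.filter⁺ _ (Uniqueₚ.cartesianProduct⁺ (Uniqueₚ.allFin⁺ r) (Uniqueₚ.allFin⁺ k))

  words      : ∀ m → Fin r → List (Vec (Fin k) m)
  extensions : ∀ m → Fin r × Fin k → List (Vec (Fin k) (suc m))

  words zero    t = filter (λ _ → q₀ ≟ᶠ t) ([] ∷ [])
  words (suc m) t = concatMap (extensions m) (into t)

  extensions m (q , a) = map (_∷ʳ a) (words m q)

  words-sound : ∀ m t {w} → w ∈ words m t → run q₀ w ≡ t
  words-sound zero    t {[]} w∈ = proj₂ (∈-filter⁻ (λ _ → q₀ ≟ᶠ t) w∈)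
  words-sound (suc m) t w∈ with find (∈-concatMap⁻ (extensions m) {xs = into t} w∈)
  ... | (q , a) , qa∈ , w∈′ with ∈-map⁻ (_∷ʳ a) w∈′
  ...   | u , u∈ , refl = begin
    run q₀ (u ∷ʳ a)   ≡⟨ run-∷ʳ q₀ u a ⟩
    δ (run q₀ u) a    ≡⟨ cong (λ q′ → δ q′ a) (words-sound m q u∈) ⟩
    δ q a             ≡⟨ into-sound qa∈ ⟩
    t                 ∎
    where open ≡-Reasoning

  words-complete : ∀ {m} (w : Vec (Fin k) m) → w ∈ words m (run q₀ w)
  words-complete {zero}  []       = ∈-filter⁺ (λ _ → q₀ ≟ᶠ q₀) (here refl) refl
  words-complete {suc m} w        with initLast w
  ... | u , a , refl rewrite run-∷ʳ q₀ u a =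
    ∈-concatMap⁺ (extensions m) (lose (into-complete (run q₀ u) a) (∈-map⁺ (_∷ʳ a) (words-complete u)))

  words-unique : ∀ m t → Unique (words m t)
  words-unique zero    t = Uniqueₚ.filter⁺ (λ _ → q₀ ≟ᶠ t) ([] ∷ [])
  words-unique (suc m) t =
    Uniqueₚ.concat⁺
      (Allₚ.map⁺ (All.tabulate λ _ → Uniqueₚ.map⁺ (Vecₚ.∷ʳ-injectiveˡ _ _) (words-unique m _)))
                    (AllPairsₚ.map⁺ (AllPairs.map disjoint (into-unique t)))
    where
    -- a word u ∷ʳ a determines the transition (run q₀ u , a) it was built along
    disjoint : ∀ {p p′} → p ≢ p′ → ∀ {v} → ¬ (v ∈ extensions m p × v ∈ extensions m p′)
    disjoint {q , a} {q′ , a′} p≢p′ (v∈ , v∈′) with ∈-map⁻ (_∷ʳ a) v∈ | ∈-map⁻ (_∷ʳ a′) v∈′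
    ... | u , u∈ , refl | u′ , u′∈ , ua≡u′a′ with Vecₚ.∷ʳ-injective u u′ ua≡u′a′
    ...   | refl , refl = p≢p′ (cong (_, a) (trans (sym (words-sound m q u∈)) (words-sound m q′ u′∈)))

  length-words : ∀ m t →
    length (words (suc m) t) ≡ sum (map (λ p → length (words m (proj₁ p))) (into t))
  length-words m t = begin
    length (concatMap (extensions m) (into t))                  ≡⟨ length-concatMap (extensions m) (into t) ⟩
    sum (map (λ p → length (extensions m p)) (into t))
      ≡⟨ cong sum (Listₚ.map-cong extension-length (into t)) ⟩
    sum (map (λ p → length (words m (proj₁ p))) (into t))       ∎
    where
    open ≡-Reasoning
    extension-length : ∀ p → length (extensions m p) ≡ length (words m (proj₁ p))
    extension-length (q , a) = Listₚ.length-map (_∷ʳ a) (words m q)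

-- Words over four letters.  A word w ∈ Letterⁿ splits [n] into four
-- blocks: X (in both A₁ and A₃), Y (only in A₁), Z (only in A₃) and W
-- (in neither).
Letter : Set
Letter = Fin 4

pattern W = zero
pattern X = suc zero
pattern Y = suc (suc zero)
pattern Z = suc (suc (suc zero))

-- Functions on letters agree if they agree on each of the four letters;
-- all identities between sets of a word below reduce to this check.
letterwise : ∀ {b} {B : Set b} {f g : Letter → B} →
             f W ≡ g W → f X ≡ g X → f Y ≡ g Y → f Z ≡ g Z → ∀ c → f c ≡ g c
letterwise eW _  _  _  W = eW
letterwise _  eX _  _  X = eX
letterwise _  _  eY _  Y = eY
letterwise _  _  _  eZ Z = eZ

inU inXY inXZ inYZ : Letter → Bool
inU W = false
inU _ = true
inXY X = true
inXY Y = true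
inXY _ = false
inXZ X = true
inXZ Z = true
inXZ _ = false
inYZ Y = true
inYZ Z = true
inYZ _ = false

inX inY inZ : Letter → Bool
inX X = true
inX _ = false
inY Y = true
inY _ = false
inZ Z = true
inZ _ = false

U XY XZ YZ : ∀ {n} → Vec Letter n → Subset n
U  = mapV inU
XY = mapV inXY
XZ = mapV inXZ
YZ = mapV inYZ

-- The candidate circuit of a word, in the order that is sorted exactly
-- when X, Y, Z all occur and first occur in this order.
circuitOf : ∀ {n} → Vec Letter n → List (Subset n)
circuitOf w = U w ∷ XY w ∷ XZ w ∷ YZ w ∷ []

sides : ∀ {n} → Vec Letter n → List (Subset n)
sides w = XY w ∷ XZ w ∷ YZ w ∷ []

Coordinatewise : (∀ {m} → Subset m → Subset m → Subset m) → Set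
Coordinatewise _⊙_ =
  ∀ {m} x y (p q : Subset m) → (x ∷ p) ⊙ (y ∷ q) ≡ head ((x ∷ []) ⊙ (y ∷ [])) ∷ (p ⊙ q)

mapV-coordinatewise : ∀ {_⊙_ : ∀ {m} → Subset m → Subset m → Subset m} → Coordinatewise _⊙_ →
  ∀ {f g h : Letter → Bool} → (∀ c → head ((f c ∷ []) ⊙ (g c ∷ [])) ≡ h c) →
  ∀ {n} (w : Vec Letter n) → mapV f w ⊙ mapV g w ≡ mapV h w
mapV-coordinatewise {_⊙_} _ _ [] with [] ⊙ []   -- the only subset of [0]
... | [] = refl
mapV-coordinatewise ⊙-cons f⊙g≡h (c ∷ w) =
  trans (⊙-cons _ _ _ _) (cong₂ _∷_ (f⊙g≡h c) (mapV-coordinatewise ⊙-cons f⊙g≡h w))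

module _ {f g h : Letter → Bool} where
  ∪-letterwise : (∀ c → head ((f c ∷ []) ∪ (g c ∷ [])) ≡ h c) →
                 ∀ {n} (w : Vec Letter n) → mapV f w ∪ mapV g w ≡ mapV h w
  ∪-letterwise = mapV-coordinatewise {_∪_} (λ _ _ _ _ → refl)

  ∩-letterwise : (∀ c → head ((f c ∷ []) ∩ (g c ∷ [])) ≡ h c) →
                 ∀ {n} (w : Vec Letter n) → mapV f w ∩ mapV g w ≡ mapV h w
  ∩-letterwise = mapV-coordinatewise {_∩_} (λ _ _ _ _ → refl)

  ─-letterwise : (∀ c → head ((f c ∷ []) ─ (g c ∷ [])) ≡ h c) →
                 ∀ {n} (w : Vec Letter n) → mapV f w ─ mapV g w ≡ mapV h w
  ─-letterwise = mapV-coordinatewise {_─_} (λ _ _ _ _ → refl)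

  △-letterwise : (∀ c → head ((f c ∷ []) △ (g c ∷ [])) ≡ h c) →
                 ∀ {n} (w : Vec Letter n) → mapV f w △ mapV g w ≡ mapV h w
  △-letterwise = mapV-coordinatewise {_△_} (λ _ _ _ _ → refl)

module _ {n} (w : Vec Letter n) where

  U-of-sides : XY w ∪ XZ w ≡ U w
  U-of-sides = ∪-letterwise (letterwise refl refl refl refl) w

  YZ-of-sides : XY w △ XZ w ≡ YZ w
  YZ-of-sides = △-letterwise (letterwise refl refl refl refl) w

  tetra-of-word : tetra (XY w) (XZ w) ≡ sides w ++ U w ∷ []
  tetra-of-word = cong₂ (λ p q → XY w ∷ XZ w ∷ p ∷ q ∷ []) YZ-of-sides U-of-sides

  ⊆-top : ∀ {x} → x ∈ sides w ++ U w ∷ [] → x ⊆ U w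
  ⊆-top 1st = subst (XY w ⊆_) U-of-sides (p⊆p∪q (XZ w))
  ⊆-top 2nd = subst (XZ w ⊆_) U-of-sides (q⊆p∪q (XY w) (XZ w))
  ⊆-top 3rd = subst (YZ w ⊆_) (∪-letterwise {g = inXY} (letterwise refl refl refl refl) w) (p⊆p∪q (XY w))
  ⊆-top 4th = ⊆-refl

  X-block : U w ─ YZ w ≡ XY w ∩ XZ w
  X-block = trans (─-letterwise {h = inX} (letterwise refl refl refl refl) w)
                  (sym (∩-letterwise (letterwise refl refl refl refl) w))

  Y-block : U w ─ XZ w ≡ XY w ─ XZ w
  Y-block = trans (─-letterwise {h = inY} (letterwise refl refl refl refl) w)
                  (sym (─-letterwise (letterwise refl refl refl refl) w))

  Z-block : U w ─ XY w ≡ XZ w ─ XY w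
  Z-block = trans (─-letterwise {h = inZ} (letterwise refl refl refl refl) w)
                  (sym (─-letterwise (letterwise refl refl refl refl) w))

side-laws : ∀ {f g h : Letter → Bool} →
  (∀ c → head ((f c ∷ []) ∪ (g c ∷ [])) ≡ inU c) →
  (∀ c → head ((f c ∷ []) △ (g c ∷ [])) ≡ h c) →
  ∀ {n} (w : Vec Letter n) → mapV f w ∪ mapV g w ≡ U w × mapV h w ≡ mapV f w △ mapV g w
side-laws ∪≡ △≡ w = ∪-letterwise ∪≡ w , sym (△-letterwise △≡ w)

triangle : ∀ {n} (w : Vec Letter n) {p q r} → p ∈ sides w → q ∈ sides w → r ∈ sides w →
           p ≢ q → q ≢ r → p ≢ r → p ∪ q ≡ U w × r ≡ p △ q
triangle w 1st 2nd 3rd _ _ _ = side-laws (letterwise refl refl refl refl) (letterwise refl refl refl refl) w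
triangle w 2nd 1st 3rd _ _ _ = side-laws (letterwise refl refl refl refl) (letterwise refl refl refl refl) w
triangle w 1st 3rd 2nd _ _ _ = side-laws (letterwise refl refl refl refl) (letterwise refl refl refl refl) w
triangle w 3rd 1st 2nd _ _ _ = side-laws (letterwise refl refl refl refl) (letterwise refl refl refl refl) w
triangle w 2nd 3rd 1st _ _ _ = side-laws (letterwise refl refl refl refl) (letterwise refl refl refl refl) w
triangle w 3rd 2nd 1st _ _ _ = side-laws (letterwise refl refl refl refl) (letterwise refl refl refl refl) w
triangle w 1st 1st _   p≢q _ _ = ⊥-elim (p≢q refl)
triangle w 2nd 2nd _   p≢q _ _ = ⊥-elim (p≢q refl)
triangle w 3rd 3rd _   p≢q _ _ = ⊥-elim (p≢q refl)
triangle w _   1st 1st _ q≢r _ = ⊥-elim (q≢r refl)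
triangle w _   2nd 2nd _ q≢r _ = ⊥-elim (q≢r refl)
triangle w _   3rd 3rd _ q≢r _ = ⊥-elim (q≢r refl)
triangle w 1st _   1st _ _ p≢r = ⊥-elim (p≢r refl)
triangle w 2nd _   2nd _ _ p≢r = ⊥-elim (p≢r refl)
triangle w 3rd _   3rd _ _ p≢r = ⊥-elim (p≢r refl)

-- Reading a word from left to right, record how many of the blocks
-- X, Y, Z have been opened, provided they open in the order X, Y, Z;
-- any other first occurrence leads to the dead state.  Accepted words
-- (state s₃) are restricted growth words: they encode the partitions of
-- [n] ∪ {n+1} into four blocks, the block W containing n+1.
State : Set
State = Fin 5

pattern s₀   = zero
pattern s₁   = suc zero
pattern s₂   = suc (suc zero)
pattern s₃   = suc (suc (suc zero))
pattern dead = suc (suc (suc (suc zero)))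

step : State → Letter → State
step s₀ W    = s₀
step s₀ X    = s₁
step s₀ _    = dead
step s₁ Z    = dead
step s₁ Y    = s₂
step s₁ _    = s₁
step s₂ Z    = s₃
step s₂ _    = s₂
step s₃ _    = s₃
step dead _  = dead

open Automaton step s₀

run-dead : ∀ {n} (w : Vec Letter n) → run dead w ≡ dead
run-dead []      = refl
run-dead (_ ∷ w) = run-dead w

run-s₃ : ∀ {n} (w : Vec Letter n) → run s₃ w ≡ s₃
run-s₃ []      = refl
run-s₃ (_ ∷ w) = run-s₃ w

dead-rejects : ∀ {n} (w : Vec Letter n) → run dead w ≢ s₃
dead-rejects w e with trans (sym (run-dead w)) e
... | ()

sorted-∷ : ∀ {n} x {L : List (Subset n)} → Sorted L → Sorted (map (x ∷_) L)
sorted-∷ x L↑ = AllPairsₚ.map⁺ (AllPairs.map ≺-there L↑)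

sorted-∷⁻ : ∀ {n} x {L : List (Subset n)} → Sorted (map (x ∷_) L) → Sorted L
sorted-∷⁻ x xL↑ = AllPairs.map tail (AllPairsₚ.map⁻ xL↑)
  where
  tail : ∀ {n} {p q : Subset n} → (x ∷ p) ≺ (x ∷ q) → p ≺ q
  tail (≺-there p≺q) = p≺q

-- What remains to be checked in state q: the part of the sortedness of
-- circuitOf w that the letters read so far have not yet decided
-- (nothing in s₃, a failed comparison in the dead state).
Pending : ∀ {n} → State → Vec Letter n → Set
Pending s₀   w = Sorted (U w ∷ XY w ∷ XZ w ∷ YZ w ∷ [])
Pending s₁   w = Sorted (U w ∷ XY w ∷ XZ w ∷ [])
Pending s₂   w = Sorted (U w ∷ XY w ∷ [])
Pending s₃   w = Sorted (U w ∷ [])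
Pending dead w = ⊥

-- A letter either prefixes the same bit to the
-- sets still compared, or decides the comparisons it separates.
pending⇒accepted : ∀ {n} q (w : Vec Letter n) → Pending q w → run q w ≡ s₃
pending⇒accepted s₀ [] ((() ∷ _) ∷ _)
pending⇒accepted s₁ [] ((() ∷ _) ∷ _)
pending⇒accepted s₂ [] ((() ∷ _) ∷ _)
pending⇒accepted s₃ w  _ = run-s₃ w
pending⇒accepted dead w ()
pending⇒accepted s₀ (W ∷ w) ↑ = pending⇒accepted s₀ w (sorted-∷⁻ outside ↑)
pending⇒accepted s₀ (X ∷ w) ((≺-there a ∷ ≺-there b ∷ _) ∷ (≺-there c ∷ _) ∷ _) =
  pending⇒accepted s₁ w ((a ∷ b ∷ []) ∷ (c ∷ []) ∷ [] ∷ [])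
pending⇒accepted s₀ (Y ∷ w) (_ ∷ _ ∷ (() ∷ _) ∷ _)
pending⇒accepted s₀ (Z ∷ w) (_ ∷ (() ∷ _) ∷ _)
pending⇒accepted s₁ (W ∷ w) ↑ = pending⇒accepted s₁ w (sorted-∷⁻ outside ↑)
pending⇒accepted s₁ (X ∷ w) ↑ = pending⇒accepted s₁ w (sorted-∷⁻ inside ↑)
pending⇒accepted s₁ (Y ∷ w) ((≺-there a ∷ _) ∷ _) = pending⇒accepted s₂ w ((a ∷ []) ∷ [] ∷ [])
pending⇒accepted s₁ (Z ∷ w) (_ ∷ (() ∷ _) ∷ _)
pending⇒accepted s₂ (W ∷ w) ↑ = pending⇒accepted s₂ w (sorted-∷⁻ outside ↑)
pending⇒accepted s₂ (X ∷ w) ↑ = pending⇒accepted s₂ w (sorted-∷⁻ inside ↑)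
pending⇒accepted s₂ (Y ∷ w) ↑ = pending⇒accepted s₂ w (sorted-∷⁻ inside ↑)
pending⇒accepted s₂ (Z ∷ w) _ = run-s₃ w

accepted⇒pending : ∀ {n} q (w : Vec Letter n) → run q w ≡ s₃ → Pending q w
accepted⇒pending s₃ w _ = [] ∷ []
accepted⇒pending dead w e = dead-rejects w e
accepted⇒pending s₀ (W ∷ w) e = sorted-∷ outside (accepted⇒pending s₀ w e)
accepted⇒pending s₀ (X ∷ w) e with accepted⇒pending s₁ w e
... | (a ∷ b ∷ []) ∷ (c ∷ []) ∷ _ =
  (≺-there a ∷ ≺-there b ∷ ≺-here ∷ []) ∷ (≺-there c ∷ ≺-here ∷ []) ∷ (≺-here ∷ []) ∷ [] ∷ []
accepted⇒pending s₀ (Y ∷ w) e = ⊥-elim (dead-rejects w e)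
accepted⇒pending s₀ (Z ∷ w) e = ⊥-elim (dead-rejects w e)
accepted⇒pending s₁ (W ∷ w) e = sorted-∷ outside (accepted⇒pending s₁ w e)
accepted⇒pending s₁ (X ∷ w) e = sorted-∷ inside (accepted⇒pending s₁ w e)
accepted⇒pending s₁ (Y ∷ w) e with accepted⇒pending s₂ w e
... | (a ∷ []) ∷ _ = (≺-there a ∷ ≺-here ∷ []) ∷ (≺-here ∷ []) ∷ [] ∷ []
accepted⇒pending s₁ (Z ∷ w) e = ⊥-elim (dead-rejects w e)
accepted⇒pending s₂ (W ∷ w) e = sorted-∷ outside (accepted⇒pending s₂ w e)
accepted⇒pending s₂ (X ∷ w) e = sorted-∷ inside (accepted⇒pending s₂ w e)
accepted⇒pending s₂ (Y ∷ w) e = sorted-∷ inside (accepted⇒pending s₂ w e)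
accepted⇒pending s₂ (Z ∷ w) e = (≺-here ∷ []) ∷ [] ∷ []

-- The numbers of words reaching s₀, …, s₃ obey the recurrence of the
-- Stirling numbers: a word reaching sⱼ either extends one reaching sⱼ
-- by one of the j+1 open blocks, or one reaching sⱼ₋₁ by opening a block.
stirling-step : ∀ j {c s} c′ {s′} → c ≡ s → c′ ≡ s′ → c′ + suc j * c ≡ suc j * s + s′
stirling-step j c′ refl refl = +-comm c′ _

count-words : ∀ m → length (words m s₀) ≡ S (suc m) 1 × length (words m s₁) ≡ S (suc m) 2 ×
                    length (words m s₂) ≡ S (suc m) 3 × length (words m s₃) ≡ S (suc m) 4
count-words zero    = refl , refl , refl , refl
count-words (suc m) with count-words m
... | e₀ , e₁ , e₂ , e₃ =
  trans (length-words m s₀) (stirling-step 0 0 e₀ refl) ,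
  trans (length-words m s₁) (stirling-step 1 _ e₁ e₀) ,
  trans (length-words m s₂) (stirling-step 2 _ e₂ e₁) ,
  trans (length-words m s₃) (stirling-step 3 _ e₃ e₂)

tetra-nonempty : ∀ {n} {A B x : Subset n} →
                 Nonempty (A ∩ B) → Nonempty (A ─ B) → x ∈ tetra A B → Nonempty x
tetra-nonempty {A = A} {B} (i , i∈A∩B) _ 1st = i , proj₁ (x∈p∩q⁻ A B i∈A∩B)
tetra-nonempty {A = A} {B} (i , i∈A∩B) _ 2nd = i , proj₂ (x∈p∩q⁻ A B i∈A∩B)
tetra-nonempty             _ (i , i∈A─B) 3rd = i , x∈p∪q⁺ (inj₁ i∈A─B)
tetra-nonempty {A = A} {B} (i , i∈A∩B) _ 4th = i , x∈p∪q⁺ (inj₁ (proj₁ (x∈p∩q⁻ A B i∈A∩B)))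

-- Every accepted word yields a tetrahedron circuit: sortedness gives
-- its place in `choose`, and the inequalities U ≺ YZ, U ≺ XZ, U ≺ XY
-- witness that the blocks X, Y, Z are nonempty.
word⇒circuit : ∀ {n} (w : Vec Letter n) → Sorted (circuitOf w) → circuitOf w ∈ tetrahedronCircuits n
word⇒circuit {n} w ↑@((U≺XY ∷ U≺XZ ∷ U≺YZ ∷ []) ∷ _) =
  ∈-filter⁺ isTetrahedron? (choose-complete (nonemptySubsets-sorted n) ↑ (All.map nonempty L⊆T))
    (XY w , XZ w , X≠∅ , Y≠∅ , Z≠∅ , L⊆T , T⊆L)
  where
  X≠∅ : Nonempty (XY w ∩ XZ w)
  X≠∅ = subst Nonempty (X-block w) (≺⇒Nonempty─ U≺YZ)
  Y≠∅ : Nonempty (XY w ─ XZ w)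
  Y≠∅ = subst Nonempty (Y-block w) (≺⇒Nonempty─ U≺XZ)
  Z≠∅ : Nonempty (XZ w ─ XY w)
  Z≠∅ = subst Nonempty (Z-block w) (≺⇒Nonempty─ U≺XY)
  L⊆T : All (_∈ tetra (XY w) (XZ w)) (circuitOf w)
  L⊆T = subst (λ T → All (_∈ T) (circuitOf w)) (sym (tetra-of-word w)) (4th ∷ 1st ∷ 2nd ∷ 3rd ∷ [])
  T⊆L : All (_∈ circuitOf w) (tetra (XY w) (XZ w))
  T⊆L = subst (All (_∈ circuitOf w)) (sym (tetra-of-word w)) (2nd ∷ 3rd ∷ 4th ∷ 1st ∷ [])
  nonempty : ∀ {x} → x ∈ tetra (XY w) (XZ w) → x ∈ nonemptySubsets n
  nonempty x∈ = ∈-nonemptySubsets n (tetra-nonempty X≠∅ Y≠∅ x∈)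

col : Bool → Bool → Letter
col true  true  = X
col true  false = Y
col false true  = Z
col false false = W

col-decode : ∀ {n} (A B : Subset n) → XY (zipWith col A B) ≡ A × XZ (zipWith col A B) ≡ B
col-decode []      []      = refl , refl
col-decode (x ∷ A) (y ∷ B) with col-decode A B
... | A≡ , B≡ = cong₂ _∷_ (first x y) A≡ , cong₂ _∷_ (second x y) B≡
  where
  first : ∀ x y → inXY (col x y) ≡ x
  first true  true  = refl
  first true  false = refl
  first false true  = refl
  first false false = refl
  second : ∀ x y → inXZ (col x y) ≡ y
  second true  true  = refl
  second true  false = refl
  second false true  = refl
  second false false = refl

col-encode : ∀ {n} (w : Vec Letter n) → zipWith col (XY w) (XZ w) ≡ w
col-encode []      = refl
col-encode (c ∷ w) = cong₂ _∷_ (col-letter c) (col-encode w)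
  where
  col-letter : ∀ c → col (inXY c) (inXZ c) ≡ c
  col-letter = letterwise refl refl refl refl

-- A word is determined by its sides XY and XZ.
circuitOf-injective : ∀ {n} {w w′ : Vec Letter n} → circuitOf w ≡ circuitOf w′ → w ≡ w′
circuitOf-injective {w = w} {w′} e = begin
  w                              ≡⟨ sym (col-encode w) ⟩
  zipWith col (XY w) (XZ w)      ≡⟨ cong₂ (zipWith col) XY≡ XZ≡ ⟩
  zipWith col (XY w′) (XZ w′)    ≡⟨ col-encode w′ ⟩
  w′                             ∎
  where
  open ≡-Reasoning
  XY≡ : XY w ≡ XY w′
  XY≡ = Listₚ.∷-injectiveˡ (Listₚ.∷-injectiveʳ e)
  XZ≡ : XZ w ≡ XZ w′
  XZ≡ = Listₚ.∷-injectiveˡ (Listₚ.∷-injectiveʳ (Listₚ.∷-injectiveʳ e))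

-- A sorted list of four members of the tetrahedron of w₀, containing
-- its top, is the circuit of a word: the top comes first, since no
-- member lies lexicographically below it, and the remaining three are
-- the sides, so the first two of them determine the word.
sorted-tetrahedron : ∀ {n} (w₀ : Vec Letter n) {L} → Sorted L → length L ≡ 4 →
                     All (_∈ sides w₀ ++ U w₀ ∷ []) L → U w₀ ∈ L → ∃[ w ] L ≡ circuitOf w
sorted-tetrahedron w₀ {a ∷ b ∷ c ∷ d ∷ []}
  ((a≺b ∷ a≺c ∷ a≺d ∷ []) ∷ (b≺c ∷ b≺d ∷ []) ∷ (c≺d ∷ []) ∷ [] ∷ []) refl
  (a∈ ∷ b∈ ∷ c∈ ∷ d∈ ∷ []) top∈ =
  w , cong₂ _∷_ a≡U (cong₂ _∷_ (sym b≡) (cong₂ _∷_ (sym c≡) (cong (_∷ []) d≡YZ)))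
  where
  T : List (Subset _)
  T = sides w₀ ++ U w₀ ∷ []
  not-above : ∀ {x y} → x ∈ T → x ≺ y → y ≢ U w₀
  not-above x∈ x≺y y≡U = ⊆⇒⊀ (⊆-top w₀ x∈) (subst (_ ≺_) y≡U x≺y)
  side : ∀ {x y} → x ∈ T → y ≺ x → y ∈ T → x ∈ sides w₀
  side 1st _ _ = 1st
  side 2nd _ _ = 2nd
  side 3rd _ _ = 3rd
  side 4th y≺U y∈ = ⊥-elim (not-above y∈ y≺U refl)
  top-first : U w₀ ∈ a ∷ b ∷ c ∷ d ∷ [] → a ≡ U w₀
  top-first 1st = refl
  top-first 2nd = ⊥-elim (not-above a∈ a≺b refl)
  top-first 3rd = ⊥-elim (not-above a∈ a≺c refl)
  top-first 4th = ⊥-elim (not-above a∈ a≺d refl)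
  laws : b ∪ c ≡ U w₀ × d ≡ b △ c
  laws = triangle w₀ (side b∈ a≺b a∈) (side c∈ a≺c a∈) (side d∈ a≺d a∈)
                  (≺⇒≢ b≺c) (≺⇒≢ c≺d) (≺⇒≢ b≺d)
  w : Vec Letter _
  w = zipWith col b c
  b≡ : XY w ≡ b
  b≡ = proj₁ (col-decode b c)
  c≡ : XZ w ≡ c
  c≡ = proj₂ (col-decode b c)
  a≡U : a ≡ U w
  a≡U = begin
    a               ≡⟨ top-first top∈ ⟩
    U w₀            ≡⟨ sym (proj₁ laws) ⟩
    b ∪ c           ≡⟨ sym (cong₂ _∪_ b≡ c≡) ⟩
    XY w ∪ XZ w     ≡⟨ U-of-sides w ⟩
    U w             ∎
    where open ≡-Reasoning
  d≡YZ : d ≡ YZ w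
  d≡YZ = begin
    d               ≡⟨ proj₂ laws ⟩
    b △ c           ≡⟨ sym (cong₂ _△_ b≡ c≡) ⟩
    XY w △ XZ w     ≡⟨ YZ-of-sides w ⟩
    YZ w            ∎
    where open ≡-Reasoning

accepted-circuit : ∀ {n} {L} → Sorted L → ∃[ w ] L ≡ circuitOf w → L ∈ map circuitOf (words n s₃)
accepted-circuit {n} L↑ (w , refl) =
  ∈-map⁺ circuitOf (subst (λ t → w ∈ words n t) (pending⇒accepted s₀ w L↑) (words-complete w))

-- Every tetrahedron circuit comes from an accepted word: being drawn by
-- `choose` from the sorted list of nonempty subsets, it is a sorted list
-- of four members of the tetrahedron of the word w₀ of (A₁ , A₃).
circuit⇒word : ∀ {n} {L} → L ∈ tetrahedronCircuits n → L ∈ map circuitOf (words n s₃)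
circuit⇒word {n} {L} L∈ with ∈-filter⁻ isTetrahedron? {xs = choose 4 (nonemptySubsets n)} L∈
... | L∈choose , A , B , _ , _ , _ , L⊆T , T⊆L =
  accepted-circuit L↑ (sorted-tetrahedron w₀ L↑ (choose-length 4 (nonemptySubsets n) L∈choose)
                         (subst (λ T → All (_∈ T) L) T≡ L⊆T) (All.lookup (subst (All (_∈ L)) T≡ T⊆L) 4th))
  where
  w₀ : Vec Letter n
  w₀ = zipWith col A B
  L↑ : Sorted L
  L↑ = choose-sorted 4 (nonemptySubsets-sorted n) L∈choose
  T≡ : tetra A B ≡ sides w₀ ++ U w₀ ∷ []
  T≡ = trans (cong₂ tetra (sym (proj₁ (col-decode A B))) (sym (proj₂ (col-decode A B)))) (tetra-of-word w₀)

circuits↭words : ∀ n → tetrahedronCircuits n ↭ map circuitOf (words n s₃)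
circuits↭words n =
  ∼bag⇒↭ (unique∧set⇒bag circuits-unique words-unique′ (mk⇔ circuit⇒word word⇒circuit′))
  where
  circuits-unique : Unique (tetrahedronCircuits n)
  circuits-unique = Uniqueₚ.filter⁺ isTetrahedron? (choose-unique 4 (nonemptySubsets-unique n))
  words-unique′ : Unique (map circuitOf (words n s₃))
  words-unique′ = Uniqueₚ.map⁺ circuitOf-injective (words-unique n s₃)
  word⇒circuit′ : ∀ {L} → L ∈ map circuitOf (words n s₃) → L ∈ tetrahedronCircuits n
  word⇒circuit′ L∈ with ∈-map⁻ circuitOf L∈
  ... | w , w∈ , refl = word⇒circuit w (accepted⇒pending s₀ w (words-sound n s₃ w∈))

-- The theorem (its count is valid for n = 0 as well).
proposition7p5 : (n : ℕ) → n ≥ 1 → numTetrahedronCircuits n ≡ S (suc n) 4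
proposition7p5 n _ = begin
  numTetrahedronCircuits n               ≡⟨ ↭-length (circuits↭words n) ⟩
  length (map circuitOf (words n s₃))    ≡⟨ Listₚ.length-map circuitOf (words n s₃) ⟩
  length (words n s₃)                    ≡⟨ proj₂ (proj₂ (proj₂ (count-words n))) ⟩
  S (suc n) 4                            ∎
  where open ≡-Reasoning
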